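{- Let $\Sigma=\{\mathsf{a},\mathsf{b}\}$ and $k\in\mathbb{N}_0$. Then the language $\mathcal{S}(\{\mathsf{a}\},\{\mathsf{b}\},k)$ contains every $x*y$-balanced string in $\Sigma^*$ of length at most $2k$.
   Context: $\Sigma^*$ is the set of finite strings over $\Sigma$, $\mathsf{e}$ the empty string; languages are subsets of $\Sigma^*$, with $+$ denoting union and juxtaposition denoting concatenation ($\mathcal{L}_1\mathcal{L}_2=\{st: s\in\mathcal{L}_1,t\in\mathcal{L}_2\}$, $\mathcal{L}^2=\mathcal{L}\mathcal{L}$). For $s\in\Sigma^*$, $|s|$ is its length, $|s|_{\mathsf{z}}$ the number of occurrences of letter $\mathsf{z}$, $s(i)$ its $i$-th letter. A string is balanced if $|s|_{\mathsf{a}}=|s|_{\mathsf{b}}$; it is $x*x$-balanced if balanced and $s(1)=s(|s|)$, and $x*y$-balanced if balanced and $s(1)\ne s(|s|)$; the empty string counts as both $x*x$- and $x*y$-balanced. For languages $\mathcal{L}_1,\mathcal{L}_2$: $\mathcal{S}(\mathcal{L}_1,\mathcal{L}_2,0)=\{\mathsf{e}\}$ and $\mathcal{S}(\mathcal{L}_1,\mathcal{L}_2,k)=\mathcal{L}_1\mathcal{S}(\mathcal{L}_1,\mathcal{L}_2,k-1)^2\mathcal{L}_2+\mathcal{L}_2\mathcal{S}(\mathcal{L}_1,\mathcal{L}_2,k-1)^2\mathcal{L}_1+\{\mathsf{e}\}$ for $k\ge1$. -}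

module Defs where

open import Data.Nat using (ℕ; zero; suc; _≤_; _*_)
open import Data.List using (List; []; _∷_; _++_; length; filter; head; last)
open import Data.Product using (Σ; ∃; ∃-syntax; _×_; _,_)
open import Data.Sum using (_⊎_)
open import Relation.Binary.PropositionalEquality using (_≡_; _≢_)
open import Relation.Nullary using (Dec; yes; no)
open import Data.Unit using (⊤)

data Letter : Set where
  a b : Letter

_≟L_ : (x y : Letter) → Dec (x ≡ y)
a ≟L a = yes _≡_.refl
a ≟L b = no (λ ())
b ≟L a = no (λ ())
b ≟L b = yes _≡_.refl

Str : Set
Str = List Letter

Lang : Set₁
Lang = Str → Set

e : Str
e = []

⟦_⟧ : Str → Lang
⟦ s ⟧ t = t ≡ s

_∪_ : Lang → Lang → Lang
(L₁ ∪ L₂) s = L₁ s ⊎ L₂ s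

_·_ : Lang → Lang → Lang
(L₁ · L₂) s = ∃[ u ] ∃[ v ] (s ≡ u ++ v × L₁ u × L₂ v)

infixl 7 _·_
infixl 6 _∪_

_² : Lang → Lang
L ² = L · L

S : Lang → Lang → ℕ → Lang
S L₁ L₂ zero = ⟦ e ⟧
S L₁ L₂ (ℕ.suc k) =
  (L₁ · (S L₁ L₂ k) ² · L₂) ∪ (L₂ · (S L₁ L₂ k) ² · L₁) ∪ ⟦ e ⟧

count : Letter → Str → ℕ
count z s = length (filter (λ x → x ≟L z) s)

Balanced : Str → Set
Balanced s = count a s ≡ count b s

-- last letter of the nonempty string y ∷ ys, i.e. s(|s|)
lastOf : Letter → Str → Letter
lastOf y [] = y
lastOf y (z ∷ zs) = lastOf z zs

-- x*y-balanced: balanced and s(1) ≠ s(|s|); the empty string counts as x*y-balanced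
XYBalanced : Str → Set
XYBalanced [] = ⊤
XYBalanced (x ∷ s) = Balanced (x ∷ s) × (x ≢ lastOf x s)

-- A nonempty x*y-balanced string is x t y with t balanced, so it suffices that every
-- balanced t lies in S(k-1)².  Either t is itself x*y-balanced, or it starts and ends with the same
-- letter x.  In that case read t as a walk (x up, the other letter y down) from 0 to 0; after its first
-- step it is at 1 and before its last step at -1, and where it first steps down to -1 it comes from 0
-- after a step down from 1, so t = (x t₁ y)(y t₂ x) with t₁, t₂ balanced.
module Submission where

open import Defs
open import Data.Nat using (ℕ; zero; suc; _+_; _*_; _≤_)
open import Data.Nat.Properties using (+-suc; +-identityʳ; +-comm; suc-injective; *-suc; ≤-trans; ≤-pred)
open import Data.List using ([]; _∷_; _++_; _∷ʳ_; [_]; length; filter; initLast; _∷ʳ′_)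
open import Data.List.Properties using (length-++; filter-++; ++-identityʳ; ++-assoc; length-++-≤ˡ; length-++-≤ʳ)
open import Data.Product using (∃-syntax; _×_; _,_)
open import Data.Sum using (inj₁; inj₂)
open import Data.Empty using (⊥-elim)
open import Data.Unit using (tt)
open import Function using (_∘_)
open import Relation.Nullary using (yes; no)
open import Relation.Binary.PropositionalEquality using (_≡_; _≢_; refl; sym; trans; cong; subst₂)

other : Letter → Letter
other a = b
other b = a

x≢other : ∀ x → x ≢ other x
x≢other a ()
x≢other b ()

≢⇒≡other : ∀ {x y} → x ≢ y → y ≡ other x
≢⇒≡other {a} {a} x≢y = ⊥-elim (x≢y refl)
≢⇒≡other {a} {b} _   = refl
≢⇒≡other {b} {a} _   = refl
≢⇒≡other {b} {b} x≢y = ⊥-elim (x≢y refl)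

data Step (x : Letter) : Letter → Set where
  up   : Step x x
  down : Step x (other x)

step : ∀ x w → Step x w
step a a = up
step a b = down
step b a = down
step b b = up

lastOf-∷ʳ : ∀ p t w → lastOf p (t ∷ʳ w) ≡ w
lastOf-∷ʳ p []      w = refl
lastOf-∷ʳ p (c ∷ t) w = lastOf-∷ʳ c t w

count-++ : ∀ z u v → count z (u ++ v) ≡ count z u + count z v
count-++ z u v = trans (cong length (filter-++ (_≟L z) u v)) (length-++ (filter (_≟L z) u))

-- Read r as a walk with x a step up and other x a step down: started at height m, it ends at height n.
Tally : Letter → Str → ℕ → ℕ → Set
Tally x r m n = m + count x r ≡ n + count (other x) r

balanced⇒tally : ∀ x {s} → Balanced s → Tally x s 0 0
balanced⇒tally a bal = bal
balanced⇒tally b bal = sym bal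

tally⇒balanced : ∀ x {s} → Tally x s 0 0 → Balanced s
tally⇒balanced a τ = τ
tally⇒balanced b τ = sym τ

tally-up⁻ : ∀ x r {m n} → Tally x (x ∷ r) m n → Tally x r (suc m) n
tally-up⁻ a r {m} τ = trans (sym (+-suc m _)) τ
tally-up⁻ b r {m} τ = trans (sym (+-suc m _)) τ

tally-up⁺ : ∀ x r {m n} → Tally x r (suc m) n → Tally x (x ∷ r) m n
tally-up⁺ a r {m} τ = trans (+-suc m _) τ
tally-up⁺ b r {m} τ = trans (+-suc m _) τ

tally-down⁻ : ∀ x r {m n} → Tally x (other x ∷ r) m n → Tally x r m (suc n)
tally-down⁻ a r {n = n} τ = trans τ (+-suc n _)
tally-down⁻ b r {n = n} τ = trans τ (+-suc n _)

tally-down⁺ : ∀ x r {m n} → Tally x r m (suc n) → Tally x (other x ∷ r) m n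
tally-down⁺ a r {n = n} τ = trans τ (sym (+-suc n _))
tally-down⁺ b r {n = n} τ = trans τ (sym (+-suc n _))

-- p is the letter before r, so that lastOf p r is the last letter of the whole string even for r = [].
first-descent : ∀ x h p r → Tally x r (suc h) 0 → lastOf p r ≡ x →
  ∃[ r₁ ] ∃[ r₂ ] (r ≡ r₁ ++ other x ∷ other x ∷ r₂
    × Tally x r₁ (suc h) 1 × Tally x (other x ∷ r₂) 0 0 × lastOf (other x) r₂ ≡ x)
first-descent x h p [] () _
first-descent x h p (w ∷ r) τ l with step x w
first-descent x h p (w ∷ r) τ l | up with first-descent x (suc h) x r (tally-up⁻ x r τ) l
... | r₁ , r₂ , refl , τ₁ , τ₂ , l₂ = x ∷ r₁ , r₂ , refl , tally-up⁺ x r₁ τ₁ , τ₂ , l₂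
first-descent x (suc h) p (w ∷ r) τ l | down
  with first-descent x h (other x) r (suc-injective (tally-down⁻ x r τ)) l
... | r₁ , r₂ , refl , τ₁ , τ₂ , l₂ = other x ∷ r₁ , r₂ , refl , tally-down⁺ x r₁ (cong suc τ₁) , τ₂ , l₂
first-descent x zero p (w ∷ []) τ l | down = ⊥-elim (x≢other x (sym l))
first-descent x zero p (w ∷ v ∷ r) τ l | down with step x v
first-descent x zero p (w ∷ v ∷ r) τ l | down | up
  with first-descent x zero x r (tally-up⁻ x r (suc-injective (tally-down⁻ x (x ∷ r) τ))) l
... | r₁ , r₂ , refl , τ₁ , τ₂ , l₂ =
  other x ∷ x ∷ r₁ , r₂ , refl , tally-down⁺ x (x ∷ r₁) (tally-up⁺ x r₁ (cong suc τ₁)) , τ₂ , l₂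
first-descent x zero p (w ∷ v ∷ r) τ l | down | down =
  [] , r , refl , refl , suc-injective (tally-down⁻ x (other x ∷ r) τ) , l

wrap : Letter → Str → Str
wrap x t = x ∷ t ∷ʳ other x

count-wrap : ∀ x z t → count z (wrap x t) ≡ suc (count z t)
count-wrap a a t = cong suc (trans (count-++ a t [ b ]) (+-identityʳ _))
count-wrap a b t = trans (count-++ b t [ b ]) (+-comm _ 1)
count-wrap b a t = trans (count-++ a t [ a ]) (+-comm _ 1)
count-wrap b b t = cong suc (trans (count-++ b t [ a ]) (+-identityʳ _))

wrap-balanced⁺ : ∀ x {t} → Balanced t → Balanced (wrap x t)
wrap-balanced⁺ x {t} bal = trans (count-wrap x a t) (trans (cong suc bal) (sym (count-wrap x b t)))

wrap-balanced⁻ : ∀ x {t} → Balanced (wrap x t) → Balanced t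
wrap-balanced⁻ x {t} bal = suc-injective (trans (sym (count-wrap x a t)) (trans bal (count-wrap x b t)))

length-wrap : ∀ x t → length (wrap x t) ≡ 2 + length t
length-wrap x t = cong suc (trans (length-++ t) (+-comm _ 1))

xyBalanced-wrap : ∀ x {t} → Balanced t → XYBalanced (wrap x t)
xyBalanced-wrap x {t} bal = wrap-balanced⁺ x bal , λ e → x≢other x (trans e (lastOf-∷ʳ x t (other x)))

xyBalanced⇒wrap : ∀ x r → XYBalanced (x ∷ r) → ∃[ t ] (r ≡ t ∷ʳ other x × Balanced t)
xyBalanced⇒wrap x r (bal , x≢last) with initLast r
... | [] = ⊥-elim (x≢last refl)
... | t ∷ʳ′ w with ≢⇒≡other (λ e → x≢last (trans e (sym (lastOf-∷ʳ x t w))))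
...   | refl = t , refl , wrap-balanced⁻ x bal

balanced-split : ∀ s → Balanced s → ∃[ u ] ∃[ v ] (s ≡ u ++ v × XYBalanced u × XYBalanced v)
balanced-split [] _ = [] , [] , refl , tt , tt
balanced-split (x ∷ r) bal with lastOf x r ≟L x
... | no last≢x = x ∷ r , [] , sym (++-identityʳ _) , (bal , last≢x ∘ sym) , tt
... | yes last≡x with first-descent x zero x r (tally-up⁻ x r (balanced⇒tally x {x ∷ r} bal)) last≡x
...   | r₁ , r₂ , refl , τ₁ , τ₂ , l₂ =
  wrap x r₁ , other x ∷ r₂ ,
  cong (x ∷_) (sym (++-assoc r₁ [ other x ] (other x ∷ r₂))) ,
  xyBalanced-wrap x (tally⇒balanced x {r₁} (suc-injective τ₁)) ,
  (tally⇒balanced x {other x ∷ r₂} τ₂ , λ e → x≢other x (sym (trans e l₂)))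

Sᵃᵇ : ℕ → Lang
Sᵃᵇ = S ⟦ a ∷ [] ⟧ ⟦ b ∷ [] ⟧

Sᵃᵇ-wrap : ∀ x {k t} → (Sᵃᵇ k ²) t → Sᵃᵇ (suc k) (wrap x t)
Sᵃᵇ-wrap a {t = t} t∈S² = inj₁ (inj₁ (a ∷ t , [ b ] , refl , ([ a ] , t , refl , refl , t∈S²) , refl))
Sᵃᵇ-wrap b {t = t} t∈S² = inj₁ (inj₂ (b ∷ t , [ a ] , refl , ([ b ] , t , refl , refl , t∈S²) , refl))

theorem2 : (k : ℕ) (s : Str) → XYBalanced s → length s ≤ 2 * k → S ⟦ a ∷ [] ⟧ ⟦ b ∷ [] ⟧ k s
theorem2 zero    []      _  _  = refl
theorem2 zero    (_ ∷ _) _  ()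
theorem2 (suc k) []      _  _  = inj₂ refl
theorem2 (suc k) (x ∷ r) xy len with xyBalanced⇒wrap x r xy
... | t , refl , bal with balanced-split t bal
...   | u , v , refl , xyu , xyv =
  Sᵃᵇ-wrap x {k} {u ++ v} (u , v , refl , theorem2 k u xyu (≤-trans (length-++-≤ˡ u {v}) len-uv) ,
                             theorem2 k v xyv (≤-trans (length-++-≤ʳ v {u}) len-uv))
  where
  len-uv : length (u ++ v) ≤ 2 * k
  len-uv = ≤-pred (≤-pred (subst₂ _≤_ (length-wrap x (u ++ v)) (*-suc 2 k) len))
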